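{- Let $\alpha\in\mathbb{C}$ and $n\ge1$. Then \[ \sum_{\lambda \vdash n}\sum_{\lambda_i \in \lambda}\lambda_i^\alpha=\sum_{\lambda \vdash n}\sum_{\substack{\lambda_i \in \lambda \\ \lambda_i \text{ distinct}}} \sigma_\alpha(\lambda_i)=\sum_{k=1}^{n}\sigma_{\alpha}(k)p(n-k). \]
   Context: $\sigma_\alpha(m)=\sum_{d\mid m} d^\alpha$. $\lambda\vdash n$ means $\lambda$ is a partition of $n$; $\sum_{\lambda_i\in\lambda}$ runs over all parts counted with multiplicity, while $\sum_{\lambda_i\in\lambda,\ \lambda_i\text{ distinct}}$ runs over the distinct part sizes, each once. $p(m)$ is the number of partitions of $m$, with $p(0)=1$. -}

module Defs where

open import Level using (Level)
open import Data.Nat using (ℕ; suc; _≤_; _≥_; _≟_)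
open import Data.Nat.Divisibility using (_∣?_)
open import Data.List using (List; []; _∷_; map; filter; upTo; deduplicate)
open import Data.Nat.ListAction using (sum)
open import Data.List.Relation.Unary.All using (All)
open import Data.List.Relation.Unary.Linked using (Linked)
open import Data.Product using (_×_)
open import Relation.Binary.PropositionalEquality using (_≡_)
open import Algebra.Bundles using (CommutativeMonoid)
import Algebra.Definitions.RawMonoid as RM

-- λ ⊢ m : a partition of m, represented canonically as a weakly decreasing
-- list of positive parts summing to m.
IsPartition : ℕ → List ℕ → Set
IsPartition m xs = All (λ x → 1 ≤ x) xs × Linked _≥_ xs × sum xs ≡ m

range1 : ℕ → List ℕ
range1 m = map suc (upTo m)

divisors : ℕ → List ℕ
divisors m = filter (_∣? m) (range1 m)

distinctParts : List ℕ → List ℕ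
distinctParts = deduplicate _≟_

module Sums {c ℓ : Level} (M : CommutativeMonoid c ℓ) where
  open CommutativeMonoid M

  Σ : List Carrier → Carrier
  Σ [] = ε
  Σ (x ∷ xs) = x ∙ Σ xs

  open RM rawMonoid public using (_×_)

  -- σ_f(m) = Σ_{d ∣ m} f(d);  with f(d) = d^α this is σ_α(m)
  σ : (ℕ → Carrier) → ℕ → Carrier
  σ f m = Σ (map f (divisors m))

-- Write m_e(λ) for the multiplicity of the part e in λ. Inserting a part k (and keeping the
-- parts sorted) maps the partitions of n − k bijectively onto the partitions of n that contain k;
-- the inverse deletes one copy of k. Hence #{λ ⊢ n : k ∈ λ} = p(n − k), and exchanging the
-- order of summation turns the middle sum into Σ_k σ_α(k) p(n − k). The same bijection gives
-- Σ_{λ ⊢ n} m_e(λ) = p(n − e) + Σ_{λ ⊢ n−e} m_e(λ), which is also the recursion satisfied by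
-- Σ_{k ≤ n, e ∣ k} p(n − k); so the left side, regrouped by part size e, equals
-- Σ_e e^α Σ_{e ∣ k ≤ n} p(n − k), which is the right side with σ_α(k) expanded over divisors.

module Submission where

open import Defs
open import Level using (Level)
open import Algebra.Bundles using (CommutativeMonoid)
open import Data.Bool using (true; false; if_then_else_)
open import Data.List using (List; []; _∷_; [_]; _++_; map; filter; length; foldr)
open import Data.List.Properties using (map-∘; filter-accept; filter-none; length-map)
open import Data.List.Membership.Propositional using (_∈_; _∉_)
open import Data.List.Membership.Propositional.Properties
  using (∈-filter⁺; ∈-filter⁻; ∈-map⁺; ∈-map⁻; ∈-∃++; ∈-upTo⁺; ∈-upTo⁻)
open import Data.List.Membership.Propositional.Properties.WithK using (unique∧set⇒bag)
open import Data.List.Relation.Binary.BagAndSetEquality using (∼bag⇒↭)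
open import Data.List.Relation.Binary.Permutation.Propositional
  using (_↭_; ↭-sym; ↭-trans; ↭-prep; ↭⇒↭ₛ; ↭⇒↭ₛ′; module PermutationReasoning)
open import Data.List.Relation.Binary.Permutation.Propositional.Properties
  using (All-resp-↭; ∈-resp-↭; ↭-length; drop-∷; shift)
import Data.List.Relation.Binary.Permutation.Propositional.Properties as ↭
import Data.List.Relation.Binary.Permutation.Setoid.Properties as ↭ₛ
open import Data.List.Relation.Unary.All as All using (All; []; _∷_)
open import Data.List.Relation.Unary.All.Properties using (map⁺)
open import Data.List.Relation.Unary.Any using (here; there)
open import Data.List.Relation.Unary.Unique.Propositional using (Unique; []; _∷_)
import Data.List.Relation.Unary.Unique.Propositional.Properties as Unique
open import Data.Nat using (ℕ; zero; suc; _+_; _∸_; _≤_; _<_; _≥_; _≟_; z≤n; s≤s)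
open import Data.Nat.Properties
open import Data.Nat.Divisibility using (_∣_; _∣?_; ∣⇒≤; ∣-refl; ∣m∣n⇒∣m+n; ∣m+n∣m⇒∣n)
open import Data.Product using (_,_; proj₁; proj₂; ∃-syntax)
open import Function using (_∘_)
open import Function.Bundles using (_⇔_; mk⇔; Equivalence)
open import Relation.Binary.Definitions using (DecidableEquality) renaming (Decidable to Decidable₂)
open import Relation.Binary.PropositionalEquality as ≡ using (_≡_; _≢_; refl)
open import Relation.Nullary using (¬_; yes; no; does)
open import Data.Nat.Induction using (<-wellFounded; Acc; acc)
open import Relation.Unary using (Decidable)

module _ {a} {A : Set a} where

  unique∧set⇒↭ : {xs ys : List A} → Unique xs → Unique ys →
                 (∀ {z} → z ∈ xs ⇔ z ∈ ys) → xs ↭ ys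
  unique∧set⇒↭ xs! ys! xs≈ys = ∼bag⇒↭ (unique∧set⇒bag xs! ys! xs≈ys)

  unique-map⁺ : ∀ {b p} {B : Set b} {P : A → Set p} {f : A → B} {xs} →
                (∀ {x y} → P x → P y → f x ≡ f y → x ≡ y) →
                All P xs → Unique xs → Unique (map f xs)
  unique-map⁺ inj [] [] = []
  unique-map⁺ inj (px ∷ pxs) (x∉xs ∷ xs!) =
    map⁺ (All.zipWith (λ (py , x≢y) fx≡fy → x≢y (inj px py fx≡fy)) (pxs , x∉xs))
    ∷ unique-map⁺ inj pxs xs!

  length-filter-↭ : ∀ {p} {P : A → Set p} (P? : Decidable P) {xs ys} →
                    xs ↭ ys → length (filter P? xs) ≡ length (filter P? ys)
  length-filter-↭ {P = P} P? xs↭ys =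
    ↭ₛ.xs↭ys⇒|xs|≡|ys| (≡.setoid A) (↭ₛ.filter⁺ (≡.setoid A) P? (≡.resp P) (↭⇒↭ₛ xs↭ys))

  ∈⇒↭∷ : ∀ {x : A} {xs} → x ∈ xs → ∃[ ys ] xs ↭ x ∷ ys
  ∈⇒↭∷ {x} x∈xs with as , bs , refl ← ∈-∃++ x∈xs = as ++ bs , shift x as bs

  filter-≡-∉ : (_≟_ : DecidableEquality A) {x : A} {xs : List A} → x ∉ xs → filter (_≟ x) xs ≡ []
  filter-≡-∉ _≟_ {x} {xs} x∉xs =
    filter-none (_≟ x) (All.tabulate λ y∈xs y≡x → x∉xs (≡.subst (_∈ xs) y≡x y∈xs))

  filter-≡-unique : (_≟_ : DecidableEquality A) {x : A} {xs : List A} →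
                    Unique xs → x ∈ xs → filter (x ≟_) xs ↭ [ x ]
  filter-≡-unique _≟_ {x} {xs} xs! x∈xs =
    unique∧set⇒↭ (Unique.filter⁺ (x ≟_) xs!) ([] ∷ []) (mk⇔ to from)
    where
      to : ∀ {z} → z ∈ filter (x ≟_) xs → z ∈ [ x ]
      to z∈ = here (≡.sym (proj₂ (∈-filter⁻ (x ≟_) {xs = xs} z∈)))
      from : ∀ {z} → z ∈ [ x ] → z ∈ filter (x ≟_) xs
      from (here refl) = ∈-filter⁺ (x ≟_) x∈xs refl

module CommutativeMonoidSums {c ℓ : Level} (M : CommutativeMonoid c ℓ) where

  open CommutativeMonoid M renaming (refl to ≈-refl; reflexive to ≈-reflexive)
  open Sums M
  open import Algebra.Properties.CommutativeSemigroup commutativeSemigroup using (interchange)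
  open import Data.List.Relation.Binary.Permutation.Setoid.Properties setoid
    using (foldr-commMonoid)
  open import Relation.Binary.Reasoning.Setoid setoid

  private
    variable
      A B : Set
      f g : A → Carrier

  Σ≡foldr : ∀ xs → Σ xs ≡ foldr _∙_ ε xs
  Σ≡foldr [] = refl
  Σ≡foldr (x ∷ xs) = ≡.cong (x ∙_) (Σ≡foldr xs)

  Σ-↭ : ∀ {xs ys} → xs ↭ ys → Σ xs ≈ Σ ys
  Σ-↭ {xs} {ys} xs↭ys = begin
    Σ xs             ≡⟨ Σ≡foldr xs ⟩
    foldr _∙_ ε xs   ≈⟨ foldr-commMonoid isCommutativeMonoid (↭⇒↭ₛ′ isEquivalence xs↭ys) ⟩
    foldr _∙_ ε ys   ≡⟨ Σ≡foldr ys ⟨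
    Σ ys             ∎

  Σ-cong : ∀ xs → (∀ {x} → x ∈ xs → f x ≈ g x) → Σ (map f xs) ≈ Σ (map g xs)
  Σ-cong [] f≈g = ≈-refl
  Σ-cong (x ∷ xs) f≈g = ∙-cong (f≈g (here refl)) (Σ-cong xs (f≈g ∘ there))

  Σ-const : ∀ (xs : List A) x → Σ (map (λ _ → x) xs) ≈ length xs × x
  Σ-const [] x = ≈-refl
  Σ-const (_ ∷ xs) x = ∙-congˡ (Σ-const xs x)

  Σ-∙ : ∀ xs → Σ (map (λ a → f a ∙ g a) xs) ≈ Σ (map f xs) ∙ Σ (map g xs)
  Σ-∙ [] = sym (identityˡ ε)
  Σ-∙ (x ∷ xs) = trans (∙-congˡ (Σ-∙ xs)) (interchange _ _ _ _)

  Σ-ε : ∀ (xs : List A) → Σ (map (λ _ → ε) xs) ≈ ε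
  Σ-ε [] = ≈-refl
  Σ-ε (_ ∷ xs) = trans (identityˡ _) (Σ-ε xs)

  ×-Σ : ∀ n xs → n × Σ (map f xs) ≈ Σ (map (λ a → n × f a) xs)
  ×-Σ zero xs = sym (Σ-ε xs)
  ×-Σ (suc n) xs = trans (∙-congˡ (×-Σ n xs)) (sym (Σ-∙ xs))

  Σ-swap : ∀ (F : A → B → Carrier) xs ys →
           Σ (map (λ a → Σ (map (F a) ys)) xs) ≈ Σ (map (λ b → Σ (map (λ a → F a b) xs)) ys)
  Σ-swap F [] ys = sym (Σ-ε ys)
  Σ-swap F (x ∷ xs) ys = trans (∙-congˡ (Σ-swap F xs ys)) (sym (Σ-∙ ys))

  Σ-filter : ∀ {p} {P : A → Set p} (P? : Decidable P) xs →
             Σ (map f (filter P? xs)) ≈ Σ (map (λ a → if does (P? a) then f a else ε) xs)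
  Σ-filter P? [] = ≈-refl
  Σ-filter P? (x ∷ xs) with does (P? x)
  ... | true  = ∙-congˡ (Σ-filter P? xs)
  ... | false = trans (Σ-filter P? xs) (sym (identityˡ _))

  Σ-filter-support : ∀ {p} {P : A → Set p} (P? : Decidable P) xs →
                     (∀ {x} → x ∈ xs → ¬ P x → f x ≈ ε) →
                     Σ (map f (filter P? xs)) ≈ Σ (map f xs)
  Σ-filter-support P? [] _ = ≈-refl
  Σ-filter-support P? (x ∷ xs) vanish with P? x
  ... | yes _  = ∙-congˡ (Σ-filter-support P? xs (vanish ∘ there))
  ... | no ¬px = trans (Σ-filter-support P? xs (vanish ∘ there))
                       (sym (trans (∙-congʳ (vanish (here refl) ¬px)) (identityˡ _)))

  Σ-comm-filter : ∀ {r} {R : A → B → Set r} (R? : Decidable₂ R) (F : A → B → Carrier) xs ys →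
                  Σ (map (λ a → Σ (map (F a) (filter (R? a) ys))) xs) ≈
                  Σ (map (λ b → Σ (map (λ a → F a b) (filter (λ a → R? a b) xs))) ys)
  Σ-comm-filter {A = A} {B = B} R? F xs ys = begin
    Σ (map (λ a → Σ (map (F a) (filter (R? a) ys))) xs)
      ≈⟨ Σ-cong xs (λ {a} _ → Σ-filter (R? a) ys) ⟩
    Σ (map (λ a → Σ (map (G a) ys)) xs)
      ≈⟨ Σ-swap G xs ys ⟩
    Σ (map (λ b → Σ (map (λ a → G a b) xs)) ys)
      ≈⟨ Σ-cong ys (λ {b} _ → Σ-filter (λ a → R? a b) xs) ⟨
    Σ (map (λ b → Σ (map (λ a → F a b) (filter (λ a → R? a b) xs))) ys) ∎
    where
      G : A → B → Carrier
      G a b = if does (R? a b) then F a b else ε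

  Σ-multiplicities : ∀ (_≟_ : DecidableEquality A) {K} xs → Unique K → (∀ {x} → x ∈ xs → x ∈ K) →
                     Σ (map f xs) ≈ Σ (map (λ e → length (filter (_≟ e) xs) × f e) K)
  Σ-multiplicities {f = f} _≟_ {K} xs K! xs⊆K = begin
    Σ (map f xs)
      ≈⟨ Σ-cong xs (λ {x} x∈xs → trans (Σ-↭ (↭.map⁺ f (filter-≡-unique _≟_ K! (xs⊆K x∈xs))))
                                        (identityʳ (f x))) ⟨
    Σ (map (λ x → Σ (map f (filter (x ≟_) K))) xs)
      ≈⟨ Σ-comm-filter (λ e x → x ≟ e) (λ e _ → f e) K xs ⟨
    Σ (map (λ e → Σ (map (λ _ → f e) (filter (_≟ e) xs))) K)
      ≈⟨ Σ-cong K (λ {e} _ → Σ-const (filter (_≟ e) xs) (f e)) ⟩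
    Σ (map (λ e → length (filter (_≟ e) xs) × f e) K) ∎

module Ranges where

  open import Data.Product using (_×_)

  ∈-range1⁻ : ∀ {n k} → k ∈ range1 n → 1 ≤ k × k ≤ n
  ∈-range1⁻ k∈ with ∈-map⁻ suc k∈
  ... | _ , j∈ , refl = s≤s z≤n , ∈-upTo⁻ j∈

  ∈-range1⁺ : ∀ {n k} → 1 ≤ k → k ≤ n → k ∈ range1 n
  ∈-range1⁺ {k = suc _} _ k≤n = ∈-map⁺ suc (∈-upTo⁺ k≤n)

  range1-unique : ∀ n → Unique (range1 n)
  range1-unique n = Unique.map⁺ suc-injective (Unique.upTo⁺ n)

  ∈-filter-range1⁻ : ∀ {p} {P : ℕ → Set p} (P? : Decidable P) n {k} →
                     k ∈ filter P? (range1 n) → P k × 1 ≤ k × k ≤ n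
  ∈-filter-range1⁻ P? n k∈ with ∈-filter⁻ P? {xs = range1 n} k∈
  ... | k∈range , Pk = Pk , ∈-range1⁻ k∈range

  divisors-↭ : ∀ {k n} → 1 ≤ k → k ≤ n → divisors k ↭ filter (_∣? k) (range1 n)
  divisors-↭ {k@(suc _)} {n} _ k≤n = unique∧set⇒↭
    (Unique.filter⁺ (_∣? k) (range1-unique k)) (Unique.filter⁺ (_∣? k) (range1-unique n))
    (mk⇔ (widen {k} {n} (λ d≤k _ → ≤-trans d≤k k≤n)) (widen {n} {k} (λ _ d∣k → ∣⇒≤ d∣k)))
    where
      widen : ∀ {m m′} → (∀ {d} → d ≤ m → d ∣ k → d ≤ m′) →
              ∀ {d} → d ∈ filter (_∣? k) (range1 m) → d ∈ filter (_∣? k) (range1 m′)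
      widen {m} bound d∈ with ∈-filter-range1⁻ (_∣? k) m d∈
      ... | d∣k , 1≤d , d≤m = ∈-filter⁺ (_∣? k) (∈-range1⁺ 1≤d (bound d≤m d∣k)) d∣k

  multiples-< : ∀ {e n} → n < e → filter (e ∣?_) (range1 n) ≡ []
  multiples-< {e} {n} n<e = filter-none (e ∣?_) (All.tabulate too-small)
    where
      too-small : ∀ {k} → k ∈ range1 n → ¬ e ∣ k
      too-small k∈ e∣k with ∈-range1⁻ k∈
      ... | s≤s z≤n , k≤n = <⇒≱ n<e (≤-trans (∣⇒≤ e∣k) k≤n)

  multiples-↭ : ∀ {e n} → 1 ≤ e → e ≤ n →
                filter (e ∣?_) (range1 n) ↭ e ∷ map (e +_) (filter (e ∣?_) (range1 (n ∸ e)))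
  multiples-↭ {e} {n} 1≤e e≤n = unique∧set⇒↭
    (Unique.filter⁺ (e ∣?_) (range1-unique n))
    (All.tabulate e∉rest ∷
       Unique.map⁺ (+-cancelˡ-≡ e _ _) (Unique.filter⁺ (e ∣?_) (range1-unique (n ∸ e))))
    (mk⇔ to from)
    where
      rest : List ℕ
      rest = map (e +_) (filter (e ∣?_) (range1 (n ∸ e)))

      e∉rest : ∀ {z} → z ∈ rest → e ≢ z
      e∉rest z∈ with ∈-map⁻ (e +_) z∈
      ... | j , j∈ , refl with ∈-filter-range1⁻ (e ∣?_) (n ∸ e) j∈
      ...   | _ , s≤s z≤n , _ = m+1+n≢m e ∘ ≡.sym

      to : ∀ {z} → z ∈ filter (e ∣?_) (range1 n) → z ∈ e ∷ rest
      to {z} z∈ with ∈-filter-range1⁻ (e ∣?_) n z∈ | z ≟ e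
      ... | _ | yes refl = here refl
      ... | e∣z , s≤s _ , z≤bound | no z≢e =
        there (≡.subst (_∈ rest) (m+[n∸m]≡n e≤z)
                 (∈-map⁺ (e +_) (∈-filter⁺ (e ∣?_) (∈-range1⁺ (m<n⇒0<n∸m e<z) (∸-monoˡ-≤ e z≤bound)) e∣z∸e)))
        where
          e≤z : e ≤ z
          e≤z = ∣⇒≤ e∣z
          e<z : e < z
          e<z = ≤∧≢⇒< e≤z (z≢e ∘ ≡.sym)
          e∣z∸e : e ∣ z ∸ e
          e∣z∸e = ∣m+n∣m⇒∣n (≡.subst (e ∣_) (≡.sym (m+[n∸m]≡n e≤z)) e∣z) ∣-refl

      from : ∀ {z} → z ∈ e ∷ rest → z ∈ filter (e ∣?_) (range1 n)
      from (here refl) = ∈-filter⁺ (e ∣?_) (∈-range1⁺ 1≤e e≤n) ∣-refl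
      from (there z∈) with ∈-map⁻ (e +_) z∈
      ... | j , j∈ , refl with ∈-filter-range1⁻ (e ∣?_) (n ∸ e) j∈
      ...   | e∣j , _ , j≤n∸e =
        ∈-filter⁺ (e ∣?_)
          (∈-range1⁺ (≤-trans 1≤e (m≤m+n e j)) (≡.subst (e + j ≤_) (m+[n∸m]≡n e≤n) (+-monoʳ-≤ e j≤n∸e)))
          (∣m∣n⇒∣m+n ∣-refl e∣j)

module Partitions where

  open import Data.Product using (_×_)
  open import Data.List.Relation.Unary.Linked using (Linked; _∷_)
  open import Data.List.Relation.Unary.Sorted.TotalOrder.Properties using (↗↭↗⇒≋)
  open import Data.List.Relation.Binary.Equality.Propositional using (≋⇒≡)
  open import Data.Nat.ListAction using (sum)
  open import Data.Nat.ListAction.Properties using (sum-↭)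
  open import Relation.Binary.Bundles using (DecTotalOrder)
  open import Relation.Binary.Properties.DecTotalOrder ≤-decTotalOrder using (≥-decTotalOrder)
  open import Data.List.Sort.InsertionSort.Base ≥-decTotalOrder public using (insert)
  open import Data.List.Sort.InsertionSort.Base ≥-decTotalOrder using (sort)
  open import Data.List.Sort.InsertionSort.Properties ≥-decTotalOrder
    using (insert-↭; insert-↗; sort-↭; sort-↗)
  open import Data.List.Membership.DecPropositional _≟_ using (_∈?_)
  open import Data.List.Relation.Unary.Unique.DecPropositional.Properties _≟_ using (deduplicate-!)
  open import Data.List.Membership.Propositional.Properties using (∈-deduplicate⁺; ∈-deduplicate⁻)
  open Ranges

  multiplicity : ℕ → List ℕ → ℕ
  multiplicity e ν = length (filter (_≟ e) ν)

  sorted-↭⇒≡ : ∀ {xs ys} → Linked _≥_ xs → Linked _≥_ ys → xs ↭ ys → xs ≡ ys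
  sorted-↭⇒≡ xs↘ ys↘ xs↭ys =
    ≋⇒≡ (↗↭↗⇒≋ (DecTotalOrder.totalOrder ≥-decTotalOrder) xs↘ ys↘ (↭⇒↭ₛ xs↭ys))

  insert-injective : ∀ {k xs ys} → Linked _≥_ xs → Linked _≥_ ys → insert k xs ≡ insert k ys → xs ≡ ys
  insert-injective {k} {xs} {ys} xs↘ ys↘ eq = sorted-↭⇒≡ xs↘ ys↘ (drop-∷ (begin
    k ∷ xs      ↭⟨ insert-↭ k xs ⟨
    insert k xs ≡⟨ eq ⟩
    insert k ys ↭⟨ insert-↭ k ys ⟩
    k ∷ ys      ∎))
    where open PermutationReasoning

  ∈-insert : ∀ k μ → k ∈ insert k μ
  ∈-insert k μ = ∈-resp-↭ (↭-sym (insert-↭ k μ)) (here refl)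

  multiplicity-insert : ∀ k μ → multiplicity k (insert k μ) ≡ suc (multiplicity k μ)
  multiplicity-insert k μ =
    ≡.trans (length-filter-↭ (_≟ k) (insert-↭ k μ)) (≡.cong length (filter-accept (_≟ k) refl))

  IsPartition-∈ : ∀ {n ν k} → IsPartition n ν → k ∈ ν → 1 ≤ k × k ≤ n
  IsPartition-∈ (ν-pos , _ , Σν≡n) k∈ν with ys , ν↭k∷ys ← ∈⇒↭∷ k∈ν with All-resp-↭ ν↭k∷ys ν-pos
  ... | 1≤k ∷ _ = 1≤k , ≡.subst (_ ≤_) (≡.trans (≡.sym (sum-↭ ν↭k∷ys)) Σν≡n) (m≤m+n _ (sum ys))

  insert-IsPartition : ∀ {k m μ} → 1 ≤ k → IsPartition m μ → IsPartition (k + m) (insert k μ)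
  insert-IsPartition {k} {m} {μ} 1≤k (μ-pos , μ↘ , Σμ≡m) =
    All-resp-↭ (↭-sym (insert-↭ k μ)) (1≤k ∷ μ-pos) ,
    insert-↗ k μ↘ ,
    ≡.trans (sum-↭ (insert-↭ k μ)) (≡.cong (k +_) Σμ≡m)

  remove-part : ∀ {n ν k} → IsPartition n ν → k ∈ ν →
                ∃[ μ ] IsPartition (n ∸ k) μ × insert k μ ≡ ν
  remove-part {n} {ν} {k} (ν-pos , ν↘ , Σν≡n) k∈ν with ys , ν↭k∷ys ← ∈⇒↭∷ k∈ν =
    sort ys , (μ-pos , sort-↗ ys , Σμ≡n∸k) , sorted-↭⇒≡ (insert-↗ k (sort-↗ ys)) ν↘ insert↭ν
    where
      k∷μ↭ν : k ∷ sort ys ↭ ν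
      k∷μ↭ν = ↭-sym (↭-trans ν↭k∷ys (↭-prep k (↭-sym (sort-↭ ys))))
      insert↭ν : insert k (sort ys) ↭ ν
      insert↭ν = ↭-trans (insert-↭ k (sort ys)) k∷μ↭ν
      μ-pos : All (1 ≤_) (sort ys)
      μ-pos with All-resp-↭ (↭-sym k∷μ↭ν) ν-pos
      ... | _ ∷ μ-pos = μ-pos
      Σμ≡n∸k : sum (sort ys) ≡ n ∸ k
      Σμ≡n∸k = ≡.trans (≡.sym (m+n∸m≡n k _)) (≡.cong (_∸ k) (≡.trans (sum-↭ k∷μ↭ν) Σν≡n))

  distinctParts-↭ : ∀ {n ν} → IsPartition n ν → distinctParts ν ↭ filter (_∈? ν) (range1 n)
  distinctParts-↭ {n} {ν} ν⊢n = unique∧set⇒↭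
    (deduplicate-! ν) (Unique.filter⁺ (_∈? ν) (range1-unique n)) (mk⇔ to from)
    where
      to : ∀ {d} → d ∈ distinctParts ν → d ∈ filter (_∈? ν) (range1 n)
      to d∈ with d∈ν ← ∈-deduplicate⁻ _≟_ ν d∈ with 1≤d , d≤n ← IsPartition-∈ ν⊢n d∈ν =
        ∈-filter⁺ (_∈? ν) (∈-range1⁺ 1≤d d≤n) d∈ν
      from : ∀ {d} → d ∈ filter (_∈? ν) (range1 n) → d ∈ distinctParts ν
      from d∈ = ∈-deduplicate⁺ _≟_ (proj₂ (∈-filter⁻ (_∈? ν) {xs = range1 n} d∈))

module PartitionFamily (P : ℕ → List (List ℕ))
                       (P-unique : ∀ m → Unique (P m))
                       (∈P⇔ : ∀ m ν → (ν ∈ P m) ⇔ IsPartition m ν) where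

  open Ranges
  open Partitions
  open import Data.List.Membership.DecPropositional _≟_ using (_∈?_)
  open Equivalence using (to; from)

  p : ℕ → ℕ
  p m = length (P m)

  containing-↭ : ∀ {k n} → 1 ≤ k → k ≤ n → filter (k ∈?_) (P n) ↭ map (insert k) (P (n ∸ k))
  containing-↭ {k} {n} 1≤k k≤n = unique∧set⇒↭
    (Unique.filter⁺ (k ∈?_) (P-unique n))
    (unique-map⁺ insert-injective (All.tabulate (proj₁ ∘ proj₂ ∘ to (∈P⇔ _ _))) (P-unique (n ∸ k)))
    (mk⇔ to′ from′)
    where
      to′ : ∀ {ν} → ν ∈ filter (k ∈?_) (P n) → ν ∈ map (insert k) (P (n ∸ k))
      to′ {ν} ν∈ with ν∈P , k∈ν ← ∈-filter⁻ (k ∈?_) ν∈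
                 with μ , μ⊢n∸k , refl ← remove-part (to (∈P⇔ n ν) ν∈P) k∈ν
        = ∈-map⁺ (insert k) (from (∈P⇔ _ μ) μ⊢n∸k)
      from′ : ∀ {ν} → ν ∈ map (insert k) (P (n ∸ k)) → ν ∈ filter (k ∈?_) (P n)
      from′ ν∈ with μ , μ∈P , refl ← ∈-map⁻ (insert k) ν∈ =
        ∈-filter⁺ (k ∈?_)
          (from (∈P⇔ n _) (≡.subst (λ m → IsPartition m (insert k μ)) (m+[n∸m]≡n k≤n)
                             (insert-IsPartition 1≤k (to (∈P⇔ _ μ) μ∈P))))
          (∈-insert k μ)

  length-containing : ∀ {k n} → 1 ≤ k → k ≤ n → length (filter (k ∈?_) (P n)) ≡ p (n ∸ k)
  length-containing {k} {n} 1≤k k≤n =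
    ≡.trans (↭-length (containing-↭ 1≤k k≤n)) (length-map (insert k) (P (n ∸ k)))

  module _ {c ℓ : Level} (M : CommutativeMonoid c ℓ) where

    open CommutativeMonoid M renaming (refl to ≈-refl; reflexive to ≈-reflexive)
    open Sums M
    open CommutativeMonoidSums M
    open import Algebra.Properties.Monoid.Mult monoid using (×-congˡ)
    open import Relation.Binary.Reasoning.Setoid setoid

    Σ-containing : ∀ {k n} (F : List ℕ → Carrier) → 1 ≤ k → k ≤ n →
                   Σ (map F (filter (k ∈?_) (P n))) ≈ Σ (map (F ∘ insert k) (P (n ∸ k)))
    Σ-containing {k} {n} F 1≤k k≤n =
      trans (Σ-↭ (↭.map⁺ F (containing-↭ 1≤k k≤n))) (≈-reflexive (≡.cong Σ (≡.sym (map-∘ (P (n ∸ k))))))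

    multiplicitySum : ℕ → Carrier → ℕ → Carrier
    multiplicitySum e y n = Σ (map (λ ν → multiplicity e ν × y) (P n))

    multiplesSum : ℕ → Carrier → ℕ → Carrier
    multiplesSum e y n = Σ (map (λ k → p (n ∸ k) × y) (filter (e ∣?_) (range1 n)))

    module _ {e : ℕ} (1≤e : 1 ≤ e) (y : Carrier) where

      multiplicitySum-< : ∀ {n} → n < e → multiplicitySum e y n ≈ ε
      multiplicitySum-< {n} n<e = trans (Σ-cong (P n) no-part-e) (Σ-ε (P n))
        where
          no-part-e : ∀ {ν} → ν ∈ P n → multiplicity e ν × y ≈ ε
          no-part-e ν∈P = ×-congˡ (≡.cong length (filter-≡-∉ _≟_ λ e∈ν →
            <⇒≱ n<e (proj₂ (IsPartition-∈ (to (∈P⇔ n _) ν∈P) e∈ν))))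

      multiplesSum-< : ∀ {n} → n < e → multiplesSum e y n ≈ ε
      multiplesSum-< {n} n<e =
        ≈-reflexive (≡.cong (λ ks → Σ (map (λ k → p (n ∸ k) × y) ks)) (multiples-< n<e))

      multiplicitySum-step : ∀ {n} → e ≤ n →
                             multiplicitySum e y n ≈ p (n ∸ e) × y ∙ multiplicitySum e y (n ∸ e)
      multiplicitySum-step {n} e≤n = begin
        multiplicitySum e y n
          ≈⟨ Σ-filter-support (e ∈?_) (P n) (λ _ e∉ν → ×-congˡ (≡.cong length (filter-≡-∉ _≟_ e∉ν))) ⟨
        Σ (map (λ ν → multiplicity e ν × y) (filter (e ∈?_) (P n)))
          ≈⟨ Σ-containing (λ ν → multiplicity e ν × y) 1≤e e≤n ⟩
        Σ (map (λ μ → multiplicity e (insert e μ) × y) (P (n ∸ e)))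
          ≈⟨ Σ-cong (P (n ∸ e)) (λ {μ} _ → ×-congˡ (multiplicity-insert e μ)) ⟩
        Σ (map (λ μ → y ∙ multiplicity e μ × y) (P (n ∸ e)))
          ≈⟨ Σ-∙ (P (n ∸ e)) ⟩
        Σ (map (λ _ → y) (P (n ∸ e))) ∙ multiplicitySum e y (n ∸ e)
          ≈⟨ ∙-congʳ (Σ-const (P (n ∸ e)) y) ⟩
        p (n ∸ e) × y ∙ multiplicitySum e y (n ∸ e) ∎

      multiplesSum-step : ∀ {n} → e ≤ n →
                          multiplesSum e y n ≈ p (n ∸ e) × y ∙ multiplesSum e y (n ∸ e)
      multiplesSum-step {n} e≤n = begin
        multiplesSum e y n
          ≈⟨ Σ-↭ (↭.map⁺ term (multiples-↭ 1≤e e≤n)) ⟩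
        term e ∙ Σ (map term (map (e +_) ks))
          ≈⟨ ∙-congˡ (≈-reflexive (≡.cong Σ (≡.sym (map-∘ ks)))) ⟩
        term e ∙ Σ (map (term ∘ (e +_)) ks)
          ≈⟨ ∙-congˡ (Σ-cong ks (λ {k} _ → ×-congˡ (≡.cong p (≡.sym (∸-+-assoc n e k))))) ⟩
        p (n ∸ e) × y ∙ multiplesSum e y (n ∸ e) ∎
        where
          term : ℕ → Carrier
          term k = p (n ∸ k) × y
          ks : List ℕ
          ks = filter (e ∣?_) (range1 (n ∸ e))

      multiplicitySum≈multiplesSum : ∀ n → multiplicitySum e y n ≈ multiplesSum e y n
      multiplicitySum≈multiplesSum n = go n (<-wellFounded n)
        where
          go : ∀ n → Acc _<_ n → multiplicitySum e y n ≈ multiplesSum e y n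
          go n (acc rec) with e ≤? n
          ... | no e≰n = trans (multiplicitySum-< (≰⇒> e≰n)) (sym (multiplesSum-< (≰⇒> e≰n)))
          ... | yes e≤n = begin
            multiplicitySum e y n                       ≈⟨ multiplicitySum-step e≤n ⟩
            p (n ∸ e) × y ∙ multiplicitySum e y (n ∸ e) ≈⟨ ∙-congˡ (go (n ∸ e) (rec (∸-monoʳ-< 1≤e e≤n))) ⟩
            p (n ∸ e) × y ∙ multiplesSum e y (n ∸ e)    ≈⟨ multiplesSum-step e≤n ⟨
            multiplesSum e y n                          ∎

    module _ (pow : ℕ → Carrier) where

      Σ-parts Σ-distinctParts convolution : ℕ → Carrier
      Σ-parts n = Σ (map (λ ν → Σ (map pow ν)) (P n))
      Σ-distinctParts n = Σ (map (λ ν → Σ (map (σ pow) (distinctParts ν))) (P n))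
      convolution n = Σ (map (λ k → p (n ∸ k) × σ pow k) (range1 n))

      Σ-parts≈Σ-multiplicitySum : ∀ n → Σ-parts n ≈ Σ (map (λ e → multiplicitySum e (pow e) n) (range1 n))
      Σ-parts≈Σ-multiplicitySum n = begin
        Σ-parts n
          ≈⟨ Σ-cong (P n) (λ ν∈P → Σ-multiplicities _≟_ _ (range1-unique n) (λ e∈ν →
               let 1≤e , e≤n = IsPartition-∈ (to (∈P⇔ n _) ν∈P) e∈ν in ∈-range1⁺ 1≤e e≤n)) ⟩
        Σ (map (λ ν → Σ (map (λ e → multiplicity e ν × pow e) (range1 n))) (P n))
          ≈⟨ Σ-swap (λ ν e → multiplicity e ν × pow e) (P n) (range1 n) ⟩
        Σ (map (λ e → multiplicitySum e (pow e) n) (range1 n)) ∎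

      convolution≈Σ-multiplesSum : ∀ n → convolution n ≈ Σ (map (λ e → multiplesSum e (pow e) n) (range1 n))
      convolution≈Σ-multiplesSum n = begin
        convolution n
          ≈⟨ Σ-cong (range1 n) (λ {k} k∈ → let 1≤k , k≤n = ∈-range1⁻ k∈ in
               trans (×-Σ (p (n ∸ k)) (divisors k)) (Σ-↭ (↭.map⁺ _ (divisors-↭ 1≤k k≤n)))) ⟩
        Σ (map (λ k → Σ (map (λ e → p (n ∸ k) × pow e) (filter (_∣? k) (range1 n)))) (range1 n))
          ≈⟨ Σ-comm-filter (λ k e → e ∣? k) (λ k e → p (n ∸ k) × pow e) (range1 n) (range1 n) ⟩
        Σ (map (λ e → multiplesSum e (pow e) n) (range1 n)) ∎

      Σ-distinctParts≈convolution : ∀ n → Σ-distinctParts n ≈ convolution n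
      Σ-distinctParts≈convolution n = begin
        Σ-distinctParts n
          ≈⟨ Σ-cong (P n) (λ ν∈P → Σ-↭ (↭.map⁺ (σ pow) (distinctParts-↭ (to (∈P⇔ n _) ν∈P)))) ⟩
        Σ (map (λ ν → Σ (map (σ pow) (filter (_∈? ν) (range1 n)))) (P n))
          ≈⟨ Σ-comm-filter (λ ν d → d ∈? ν) (λ _ d → σ pow d) (P n) (range1 n) ⟩
        Σ (map (λ d → Σ (map (λ _ → σ pow d) (filter (d ∈?_) (P n)))) (range1 n))
          ≈⟨ Σ-cong (range1 n) (λ {d} d∈ → let 1≤d , d≤n = ∈-range1⁻ d∈ in
               trans (Σ-const (filter (d ∈?_) (P n)) (σ pow d)) (×-congˡ (length-containing 1≤d d≤n))) ⟩
        convolution n ∎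

      Σ-parts≈convolution : ∀ n → Σ-parts n ≈ convolution n
      Σ-parts≈convolution n = begin
        Σ-parts n
          ≈⟨ Σ-parts≈Σ-multiplicitySum n ⟩
        Σ (map (λ e → multiplicitySum e (pow e) n) (range1 n))
          ≈⟨ Σ-cong (range1 n) (λ {e} e∈ → multiplicitySum≈multiplesSum (proj₁ (∈-range1⁻ e∈)) (pow e) n) ⟩
        Σ (map (λ e → multiplesSum e (pow e) n) (range1 n))
          ≈⟨ convolution≈Σ-multiplesSum n ⟨
        convolution n ∎

open import Data.Product using (_×_)

corollary7 : ∀ {c ℓ : Level} (M : CommutativeMonoid c ℓ)
    → (pow : ℕ → CommutativeMonoid.Carrier M)
    → (P : ℕ → List (List ℕ))
    → (∀ m → Unique (P m))
    → (∀ m xs → (xs ∈ P m) ⇔ IsPartition m xs)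
    → (n : ℕ) → 1 ≤ n
    → CommutativeMonoid._≈_ M
    (Sums.Σ M (map (λ lam → Sums.Σ M (map pow lam)) (P n)))
    (Sums.Σ M (map (λ lam → Sums.Σ M (map (Sums.σ M pow) (distinctParts lam))) (P n)))
    × CommutativeMonoid._≈_ M
    (Sums.Σ M (map (λ lam → Sums.Σ M (map (Sums.σ M pow) (distinctParts lam))) (P n)))
    (Sums.Σ M (map (λ k → Sums._×_ M (length (P (n ∸ k))) (Sums.σ M pow k)) (range1 n)))
corollary7 M pow P P-unique ∈P⇔ n _ =
  trans (Σ-parts≈convolution M pow n) (sym (Σ-distinctParts≈convolution M pow n)) ,
  Σ-distinctParts≈convolution M pow n
  where
    open PartitionFamily P P-unique ∈P⇔
    open CommutativeMonoid M using (trans; sym)
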